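{- Let $G$ be a finite non-cyclic abelian group. Then $\kappa(\mathcal{G}_e(G))=1$ if and only if $G$ is a $p$-group for some prime $p$.
   Context: For a finite group $G$, the enhanced power graph $\mathcal{G}_e(G)$ is the simple graph with vertex set $G$ in which two distinct vertices $u,v$ are adjacent if and only if there exists $w\in G$ such that both $u$ and $v$ are powers of $w$. For a graph $\Gamma$, the vertex connectivity $\kappa(\Gamma)$ is the minimum number of vertices whose removal leaves an induced subgraph that is disconnected. A $p$-group is a group of order $p^r$, $r\in\mathbb{N}$. -}

module Defs where

open import Level using (0ℓ)
open import Data.Nat using (ℕ; zero; suc; _≤_; _^_)
open import Data.Nat.Primality using (Prime)
open import Data.Fin using (Fin)
open import Data.Fin.Subset using (Subset; _∈_; _∉_; ∣_∣)
open import Data.Product using (Σ; ∃; _×_)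
open import Relation.Nullary using (¬_)
open import Relation.Binary.PropositionalEquality using (_≡_)
open import Algebra.Structures using (IsGroup)

-- A finite group of order n, presented on the carrier Fin n
-- (every finite group is isomorphic to one of this form).
record FinGroup (n : ℕ) : Set where
  infixl 7 _∙_
  field
    _∙_     : Fin n → Fin n → Fin n
    ε       : Fin n
    _⁻¹     : Fin n → Fin n
    isGroup : IsGroup _≡_ _∙_ ε _⁻¹

  pow : Fin n → ℕ → Fin n
  pow g zero    = ε
  pow g (suc k) = g ∙ pow g k

  -- u is a power of w (in a finite group, powers with ℕ exponents
  -- give all of ⟨w⟩)
  IsPowerOf : Fin n → Fin n → Set
  IsPowerOf u w = ∃ λ k → u ≡ pow w k

open FinGroup public

IsAbelian : ∀ {n} → FinGroup n → Set
IsAbelian G = ∀ x y → _∙_ G x y ≡ _∙_ G y x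

IsCyclic : ∀ {n} → FinGroup n → Set
IsCyclic G = ∃ λ g → ∀ x → IsPowerOf G x g

IsPGroup : ∀ {n} → FinGroup n → Set
IsPGroup {n} G = ∃ λ p → Prime p × ∃ λ r → n ≡ p ^ r

EnhancedPowerAdj : ∀ {n} → FinGroup n → Fin n → Fin n → Set
EnhancedPowerAdj {n} G u v =
  ¬ (u ≡ v) × ∃ λ w → IsPowerOf G u w × IsPowerOf G v w

-- Reach adj S a b : there is a path from a to b in the subgraph induced
-- on the vertices not in S (a is assumed to lie outside S by the user).
data Reach {n : ℕ} (adj : Fin n → Fin n → Set) (S : Subset n)
           : Fin n → Fin n → Set where
  here : ∀ {a} → Reach adj S a a
  step : ∀ {a b c} → adj a b → b ∉ S → Reach adj S b c → Reach adj S a c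

Disconnects : ∀ {n} → (Fin n → Fin n → Set) → Subset n → Set
Disconnects adj S =
  ∃ λ a → ∃ λ b → a ∉ S × b ∉ S × ¬ Reach adj S a b

VertexConnectivityIs : ∀ {n} → (Fin n → Fin n → Set) → ℕ → Set
VertexConnectivityIs {n} adj k =
  (∃ λ (S : Subset n) → ∣ S ∣ ≡ k × Disconnects adj S)
  × (∀ (S : Subset n) → Disconnects adj S → k ≤ ∣ S ∣)

-- Since ε is a power of every element, it is adjacent to all other vertices, so a disconnecting
-- set must contain ε, and κ = 1 means exactly that removing ε disconnects the graph.
-- If two primes p ≠ q divide |G|, then two elements u, v of orders p and q are both powers of u v,
-- so every non-identity element (through a power of prime order) reaches a fixed element of
-- order p, and the graph minus ε is connected.  If |G| = pʳ, every cyclic subgroup ≠ 1 has a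
-- unique subgroup of order p, and two adjacent vertices ≠ ε, lying in a common cyclic subgroup,
-- have the same one; so it is constant on components.  For x of maximal order, a non-cyclic G has
-- an element z of order p outside ⟨x⟩, and then x and z lie in different components.
-- Lagrange and Cauchy come from building G as ⟨g₁⟩⟨g₂⟩⋯⟨gₖ⟩, each step multiplying the size
-- by the index of the previous subgroup in the next one.
module Submission where

open import Defs hiding (_∙_; ε; _⁻¹; isGroup; pow; IsPowerOf)
open import Data.Nat using (ℕ)
open import Relation.Nullary using (¬_)
open import Function.Bundles using (_⇔_)

open import Level using (0ℓ)
open import Data.Nat
  using (zero; suc; _+_; _*_; _∸_; _^_; _≤_; _<_; _≟_; _≤?_; z≤n; s≤s; z<s; NonZero; nonTrivial⇒n>1)
open import Data.Nat.Properties
open import Data.Nat.Divisibility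
open import Data.Nat.DivMod
open import Data.Nat.Primality
open import Data.Nat.Primality.Factorisation using (factorise)
open import Data.Nat.ListAction using (product)
open import Data.Nat.ListAction.Properties using (∈⇒∣product)
open import Data.Nat.Coprimality as Coprime using (Coprime; coprime-Bézout; coprime-divisor)
open import Data.Nat.GCD using (module Bézout)
open import Data.Fin as Fin using (Fin; toℕ; fromℕ<)
import Data.Fin.Properties as Fin
open import Data.Fin.Subset using (Subset; _∈_; _∉_; _⊆_; ∣_∣; ⁅_⁆; _-_)
open import Data.Fin.Subset.Properties
  using (x∈⁅x⁆; x∈⁅y⁆⇒x≡y; x∉⁅y⁆⇒x≢y; x≢y⇒x∉⁅y⁆; ∣⁅x⁆∣≡1; x∈p∧x≢y⇒x∈p-y; x∈p⇒∣p-x∣<∣p∣; _∈?_)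
open import Data.List using (List; []; _∷_; length; allFin)
open import Data.List.Relation.Unary.All as All using (All; []; _∷_)
open import Data.List.Relation.Unary.Any using (here; there)
open import Data.List.Membership.Propositional using () renaming (_∈_ to _∈ₗ_)
open import Data.List.Membership.Propositional.Properties using (∈-allFin)
open import Data.List.Extrema.Nat using (argmax; f[xs]≤f[argmax])
open import Function using (_∘_)
open import Data.Product using (∃; _×_; _,_; proj₁; proj₂; uncurry)
open import Data.Sum using (_⊎_; inj₁; inj₂)
open import Function.Bundles using (mk⇔)
open import Relation.Nullary using (Dec; yes; no; ¬?)
open import Relation.Nullary.Negation using (contradiction)
open import Relation.Nullary.Decidable using (decidable-stable)
open import Relation.Unary using (Decidable)
open import Relation.Binary.Definitions using (Symmetric; tri<; tri≈; tri>)
open import Relation.Binary.PropositionalEquality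
open import Algebra.Bundles using (AbelianGroup)

-- Arithmetic

prime>1 : ∀ {p} → Prime p → 1 < p
prime>1 {p} pp = nonTrivial⇒n>1 p {{prime⇒nonTrivial pp}}

prime∤⇒coprime : ∀ {p m} → Prime p → ¬ p ∣ m → Coprime p m
prime∤⇒coprime pp p∤m (d∣p , d∣m) with prime⇒irreducible pp d∣p
... | inj₁ d≡1 = d≡1
... | inj₂ refl = contradiction d∣m p∤m

distinctPrimes⇒coprime : ∀ {p q} → Prime p → Prime q → p ≢ q → Coprime p q
distinctPrimes⇒coprime pp pq p≢q = prime∤⇒coprime pp p∤q
  where
  p∤q : ¬ _ ∣ _
  p∤q p∣q with prime⇒irreducible pq p∣q
  ... | inj₁ refl = ¬prime[1] pp
  ... | inj₂ p≡q = p≢q p≡q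

∃-prime-divisor : ∀ {m} → 1 < m → ∃ λ p → Prime p × p ∣ m
∃-prime-divisor {m@(suc _)} 1<m with factorise m
... | record { factors = [] ; isFactorisation = m≡1 } = contradiction m≡1 (>⇒≢ 1<m)
... | record { factors = p ∷ ps ; isFactorisation = m≡Πps ; factorsPrime = pp ∷ _ } =
      p , pp , subst (p ∣_) (sym m≡Πps) (∈⇒∣product {ns = p ∷ ps} (here refl))

∣p^r⇒≡p^m : ∀ {p} → Prime p → ∀ r {d} → d ∣ p ^ r → ∃ λ m → d ≡ p ^ m
∣p^r⇒≡p^m pp zero d∣1 = 0 , ∣1⇒≡1 d∣1
∣p^r⇒≡p^m {p} pp (suc r) {d} d∣p^1+r with p ∣? d
... | no p∤d = ∣p^r⇒≡p^m pp r (coprime-divisor (Coprime.sym (prime∤⇒coprime pp p∤d)) d∣p^1+r)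
... | yes (divides c refl)
  with ∣p^r⇒≡p^m pp r {c}
         (*-cancelʳ-∣ p {{prime⇒nonZero pp}} (subst (c * p ∣_) (*-comm p (p ^ r)) d∣p^1+r))
...   | m , refl = suc m , *-comm (p ^ m) p

^-monoʳ-∣ : ∀ p {a b} → a ≤ b → p ^ a ∣ p ^ b
^-monoʳ-∣ p {a} {b} a≤b = divides (p ^ (b ∸ a)) (begin
    p ^ b               ≡⟨ cong (p ^_) (m+[n∸m]≡n a≤b) ⟨
    p ^ (a + (b ∸ a))   ≡⟨ ^-distribˡ-+-* p a (b ∸ a) ⟩
    p ^ a * p ^ (b ∸ a) ≡⟨ *-comm (p ^ a) _ ⟩
    p ^ (b ∸ a) * p ^ a ∎)
  where open ≡-Reasoning

^≤^⇒^∣^ : ∀ {p a b} → 1 < p → p ^ a ≤ p ^ b → p ^ a ∣ p ^ b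
^≤^⇒^∣^ {p} {a} {b} 1<p pᵃ≤pᵇ with a ≤? b
... | yes a≤b = ^-monoʳ-∣ p a≤b
... | no a≰b = contradiction pᵃ≤pᵇ (<⇒≱ (^-monoʳ-< p 1<p (≰⇒> a≰b)))

product-constant : ∀ {p} fs → All (_≡ p) fs → product fs ≡ p ^ length fs
product-constant [] [] = refl
product-constant (f ∷ fs) (refl ∷ fs≡p) = cong (f *_) (product-constant fs fs≡p)

uniquePrimeDivisor⇒primePower : ∀ m .{{_ : NonZero m}} →
  (∀ {p q} → Prime p → Prime q → p ∣ m → q ∣ m → p ≡ q) →
  ∃ λ p → Prime p × ∃ λ r → m ≡ p ^ r
uniquePrimeDivisor⇒primePower m unique with factorise m
... | record { factors = [] ; isFactorisation = m≡1 } = 2 , prime[2] , 0 , m≡1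
... | record { factors = p ∷ ps ; isFactorisation = m≡Πps ; factorsPrime = pp ∷ psPrime } =
      p , pp , suc (length ps) , trans m≡Πps (product-constant (p ∷ ps) (refl ∷ ps≡p))
  where
  divides-m : ∀ {q} → q ∈ₗ p ∷ ps → q ∣ m
  divides-m q∈ = subst (_ ∣_) (sym m≡Πps) (∈⇒∣product {ns = p ∷ ps} q∈)
  ps≡p : All (_≡ p) ps
  ps≡p = All.tabulate λ q∈ps →
    unique (All.lookup psPrime q∈ps) pp (divides-m (there q∈ps)) (divides-m (here refl))

Least : (ℕ → Set) → Set
Least P = ∃ λ m → P m × (∀ {j} → j < m → ¬ P j)

module _ {P : ℕ → Set} (P? : Decidable P) where

  noneBelow⊎least : ∀ k → (∀ {j} → j < k → ¬ P j) ⊎ Least P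
  noneBelow⊎least zero = inj₁ λ ()
  noneBelow⊎least (suc k) with noneBelow⊎least k
  ... | inj₂ l = inj₂ l
  ... | inj₁ none with P? k
  ...   | yes pk = inj₂ (k , pk , none)
  ...   | no ¬pk = inj₁ below
    where
    below : ∀ {j} → j < suc k → ¬ P j
    below (s≤s j≤k) with m≤n⇒m<n∨m≡n j≤k
    ... | inj₁ j<k = none j<k
    ... | inj₂ refl = ¬pk

  least : ∀ {k} → P k → Least P
  least {k} pk with noneBelow⊎least (suc k)
  ... | inj₂ l = l
  ... | inj₁ none = contradiction pk (none ≤-refl)

-- Subsets and reachability

x∈p⇒∣p∣>0 : ∀ {n} {p : Subset n} {x} → x ∈ p → 0 < ∣ p ∣
x∈p⇒∣p∣>0 x∈p = ≤-<-trans z≤n (x∈p⇒∣p-x∣<∣p∣ x∈p)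

∣p∣≡1∧x∈p⇒p⊆⁅x⁆ : ∀ {n} {p : Subset n} {x} → ∣ p ∣ ≡ 1 → x ∈ p → p ⊆ ⁅ x ⁆
∣p∣≡1∧x∈p⇒p⊆⁅x⁆ {p = p} {x} ∣p∣≡1 x∈p {y} y∈p with y Fin.≟ x
... | yes refl = x∈⁅x⁆ x
... | no y≢x = contradiction (≤-<-trans (x∈p⇒∣p∣>0 (x∈p∧x≢y⇒x∈p-y y∈p y≢x))
                                        (subst (∣ p - x ∣ <_) ∣p∣≡1 (x∈p⇒∣p-x∣<∣p∣ x∈p)))
                             (<-irrefl refl)

module _ {n} {adj : Fin n → Fin n → Set} {S : Subset n} where

  reach-++ : ∀ {a b c} → Reach adj S a b → Reach adj S b c → Reach adj S a c
  reach-++ here r = r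
  reach-++ (step ab b∉S r) r′ = step ab b∉S (reach-++ r r′)

  reach-snoc : ∀ {a b c} → Reach adj S a b → adj b c → c ∉ S → Reach adj S a c
  reach-snoc r bc c∉S = reach-++ r (step bc c∉S here)

  reach-sym : Symmetric adj → ∀ {a b} → a ∉ S → Reach adj S a b → Reach adj S b a
  reach-sym adj-sym a∉S here = here
  reach-sym adj-sym a∉S (step ab b∉S r) = reach-snoc (reach-sym adj-sym b∉S r) (adj-sym ab) a∉S

module FiniteAbelianGroup {n} (G : FinGroup n) (G-abelian : IsAbelian G) where

  open FinGroup G

  abelianGroup : AbelianGroup 0ℓ 0ℓ
  abelianGroup = record
    { Carrier = Fin n ; _≈_ = _≡_ ; _∙_ = _∙_ ; ε = ε ; _⁻¹ = _⁻¹
    ; isAbelianGroup = record { isGroup = isGroup ; comm = G-abelian }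
    }

  open AbelianGroup abelianGroup
    using (assoc; identityˡ; identityʳ; comm; group; commutativeSemigroup)
  open import Algebra.Properties.Group group
    using (∙-cancelˡ; ∙-cancelʳ; inverseˡ-unique; inverseʳ-unique; x≈z//y; //-rightDividesˡ; ε⁻¹≈ε)
  open import Algebra.Properties.CommutativeSemigroup commutativeSemigroup using (interchange)

  -- Powers and orders

  pow-+ : ∀ g a b → pow g (a + b) ≡ pow g a ∙ pow g b
  pow-+ g zero b = sym (identityˡ _)
  pow-+ g (suc a) b = trans (cong (g ∙_) (pow-+ g a b)) (sym (assoc _ _ _))

  pow-* : ∀ g a b → pow g (a * b) ≡ pow (pow g a) b
  pow-* g a zero = cong (pow g) (*-zeroʳ a)
  pow-* g a (suc b) = begin
      pow g (a * suc b)           ≡⟨ cong (pow g) (*-suc a b) ⟩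
      pow g (a + a * b)           ≡⟨ pow-+ g a (a * b) ⟩
      pow g a ∙ pow g (a * b)     ≡⟨ cong (pow g a ∙_) (pow-* g a b) ⟩
      pow g a ∙ pow (pow g a) b   ∎
    where open ≡-Reasoning

  pow-ε : ∀ k → pow ε k ≡ ε
  pow-ε zero = refl
  pow-ε (suc k) = trans (identityˡ _) (pow-ε k)

  pow-1 : ∀ g → pow g 1 ≡ g
  pow-1 = identityʳ

  pow-∙ : ∀ x y k → pow (x ∙ y) k ≡ pow x k ∙ pow y k
  pow-∙ x y zero = sym (identityˡ ε)
  pow-∙ x y (suc k) = trans (cong ((x ∙ y) ∙_) (pow-∙ x y k)) (interchange x y _ _)

  pow-divMod : ∀ g j .{{_ : NonZero j}} t → pow g t ≡ pow g (t % j) ∙ pow (pow g j) (t / j)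
  pow-divMod g j t = begin
      pow g t                                 ≡⟨ cong (pow g) (m≡m%n+[m/n]*n t j) ⟩
      pow g (t % j + t / j * j)               ≡⟨ pow-+ g (t % j) (t / j * j) ⟩
      pow g (t % j) ∙ pow g (t / j * j)       ≡⟨ cong (λ k → pow g (t % j) ∙ pow g k) (*-comm (t / j) j) ⟩
      pow g (t % j) ∙ pow g (j * (t / j))     ≡⟨ cong (pow g (t % j) ∙_) (pow-* g j (t / j)) ⟩
      pow g (t % j) ∙ pow (pow g j) (t / j)   ∎
    where open ≡-Reasoning

  -- Among the n + 1 powers g⁰, …, gⁿ two coincide.
  pow-periodic : ∀ g → ∃ λ d → pow g (suc d) ≡ ε
  pow-periodic g with Fin.pigeonhole (n<1+n n) (λ (i : Fin (suc n)) → pow g (toℕ i))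
  ... | i , j , i<j , gⁱ≡gʲ = d , ∙-cancelˡ (pow g (toℕ i)) _ _ (begin
      pow g (toℕ i) ∙ pow g (suc d)   ≡⟨ pow-+ g (toℕ i) (suc d) ⟨
      pow g (toℕ i + suc d)           ≡⟨ cong (pow g) (trans (+-suc (toℕ i) d) (m+[n∸m]≡n i<j)) ⟩
      pow g (toℕ j)                   ≡⟨ gⁱ≡gʲ ⟨
      pow g (toℕ i)                   ≡⟨ identityʳ _ ⟨
      pow g (toℕ i) ∙ ε               ∎)
    where
    open ≡-Reasoning
    d = toℕ j ∸ suc (toℕ i)

  record IsSubgroup (H : Fin n → Set) : Set where
    field
      ε∈ : H ε
      ∙-closed : ∀ {x y} → H x → H y → H (x ∙ y)
      ⁻¹-closed : ∀ {x} → H x → H (x ⁻¹)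

    pow-closed : ∀ {x} k → H x → H (pow x k)
    pow-closed zero x∈H = ε∈
    pow-closed (suc k) x∈H = ∙-closed x∈H (pow-closed k x∈H)

    ∙∈∧∈⇒∈ : ∀ {x y} → H (x ∙ y) → H y → H x
    ∙∈∧∈⇒∈ {x} {y} xy∈H y∈H = subst H (sym (x≈z//y x y (x ∙ y) refl)) (∙-closed xy∈H (⁻¹-closed y∈H))

  -- the order of gH in G/H
  module Modulo {H : Fin n → Set} (H? : Decidable H) (H-sub : IsSubgroup H) (g : Fin n) where

    open IsSubgroup H-sub

    -- abstract: unfolding the search makes type checking of later statements about orders explode
    abstract
      least-order : Least (λ d → H (pow g (suc d)))
      least-order = least (λ d → H? (pow g (suc d))) {proj₁ (pow-periodic g)}
                          (subst H (sym (proj₂ (pow-periodic g))) ε∈)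

    order : ℕ
    order = suc (proj₁ least-order)

    pow-order∈ : H (pow g order)
    pow-order∈ = proj₁ (proj₂ least-order)

    order-minimal : ∀ {i} → 0 < i → i < order → ¬ H (pow g i)
    order-minimal {suc i} _ (s≤s i<) = proj₂ (proj₂ least-order) i<

    pow∈⇒order∣ : ∀ {t} → H (pow g t) → order ∣ t
    pow∈⇒order∣ {t} gᵗ∈H with t % order in t%o≡r
    ... | zero = m%n≡0⇒n∣m t order t%o≡r
    ... | suc r = contradiction (subst (λ k → H (pow g k)) t%o≡r remainder∈H)
                    (order-minimal z<s (subst (_< order) t%o≡r (m%n<n t order)))
      where
      remainder∈H : H (pow g (t % order))
      remainder∈H = ∙∈∧∈⇒∈ (subst H (pow-divMod g order t) gᵗ∈H) (pow-closed (t / order) pow-order∈)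

    private
      cosets-disjoint< : ∀ {i i′} → i < i′ → i′ < order → ∀ {h h′} → H h → H h′ →
                         pow g i ∙ h ≢ pow g i′ ∙ h′
      cosets-disjoint< {i} {i′} i<i′ i′<o {h} {h′} h∈H h′∈H eq =
        order-minimal (m<n⇒0<n∸m i<i′) (≤-<-trans (m∸n≤m i′ i) i′<o)
          (∙∈∧∈⇒∈ (subst H h≡gᵈh′ h∈H) h′∈H)
        where
        h≡gᵈh′ : h ≡ pow g (i′ ∸ i) ∙ h′
        h≡gᵈh′ = ∙-cancelˡ (pow g i) _ _ (begin
            pow g i ∙ h                         ≡⟨ eq ⟩
            pow g i′ ∙ h′                       ≡⟨ cong (λ k → pow g k ∙ h′) (m+[n∸m]≡n (<⇒≤ i<i′)) ⟨
            pow g (i + (i′ ∸ i)) ∙ h′           ≡⟨ cong (_∙ h′) (pow-+ g i (i′ ∸ i)) ⟩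
            pow g i ∙ pow g (i′ ∸ i) ∙ h′       ≡⟨ assoc _ _ _ ⟩
            pow g i ∙ (pow g (i′ ∸ i) ∙ h′)     ∎)
          where open ≡-Reasoning

    cosets-disjoint : ∀ {i i′} → i < order → i′ < order → ∀ {h h′} → H h → H h′ →
                      pow g i ∙ h ≡ pow g i′ ∙ h′ → i ≡ i′
    cosets-disjoint {i} {i′} i<o i′<o h∈H h′∈H eq with <-cmp i i′
    ... | tri< i<i′ _ _ = contradiction eq (cosets-disjoint< i<i′ i′<o h∈H h′∈H)
    ... | tri≈ _ i≡i′ _ = i≡i′
    ... | tri> _ _ i>i′ = contradiction (sym eq) (cosets-disjoint< i>i′ i<o h′∈H h∈H)

  trivial-isSubgroup : IsSubgroup (_≡ ε)
  trivial-isSubgroup = record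
    { ε∈ = refl
    ; ∙-closed = λ { refl refl → identityˡ ε }
    ; ⁻¹-closed = λ { refl → ε⁻¹≈ε }
    }

  order : Fin n → ℕ
  order = Modulo.order (Fin._≟ ε) trivial-isSubgroup

  pow-order : ∀ g → pow g (order g) ≡ ε
  pow-order = Modulo.pow-order∈ (Fin._≟ ε) trivial-isSubgroup

  order-minimal : ∀ g {i} → 0 < i → i < order g → pow g i ≢ ε
  order-minimal = Modulo.order-minimal (Fin._≟ ε) trivial-isSubgroup

  pow≡ε⇒order∣ : ∀ g {t} → pow g t ≡ ε → order g ∣ t
  pow≡ε⇒order∣ = Modulo.pow∈⇒order∣ (Fin._≟ ε) trivial-isSubgroup

  pow-mod-order : ∀ g t → pow g t ≡ pow g (t % order g)
  pow-mod-order g t = begin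
      pow g t                             ≡⟨ pow-divMod g (order g) t ⟩
      pow g r ∙ pow (pow g (order g)) q   ≡⟨ cong (λ h → pow g r ∙ pow h q) (pow-order g) ⟩
      pow g r ∙ pow ε q                   ≡⟨ cong (pow g r ∙_) (pow-ε q) ⟩
      pow g r ∙ ε                         ≡⟨ identityʳ _ ⟩
      pow g r                             ∎
    where
    open ≡-Reasoning
    r = t % order g
    q = t / order g

  pow-multiple≡ε : ∀ {y b} → pow y b ≡ ε → ∀ c → pow y (c * b) ≡ ε
  pow-multiple≡ε {y} {b} yᵇ≡ε c = begin
      pow y (c * b)      ≡⟨ cong (pow y) (*-comm c b) ⟩
      pow y (b * c)      ≡⟨ pow-* y b c ⟩
      pow (pow y b) c    ≡⟨ cong (λ z → pow z c) yᵇ≡ε ⟩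
      pow ε c            ≡⟨ pow-ε c ⟩
      ε                  ∎
    where open ≡-Reasoning

  order≡1⇒≡ε : ∀ x → order x ≡ 1 → x ≡ ε
  order≡1⇒≡ε x o≡1 = trans (sym (pow-1 x)) (trans (cong (pow x) (sym o≡1)) (pow-order x))

  order∣⇒pow≡ε : ∀ g {t} → order g ∣ t → pow g t ≡ ε
  order∣⇒pow≡ε g (divides q refl) = pow-multiple≡ε (pow-order g) q

  order≤order-ε⇒≡ε : ∀ x → order x ≤ order ε → x ≡ ε
  order≤order-ε⇒≡ε x o≤oε =
    order≡1⇒≡ε x (≤-antisym (≤-trans o≤oε (∣⇒≤ (pow≡ε⇒order∣ ε (pow-1 ε)))) (s≤s z≤n))

  ⁻¹≡pow : ∀ x → x ⁻¹ ≡ pow x (order x ∸ 1)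
  ⁻¹≡pow x = sym (inverseʳ-unique x _ (pow-order x))

  closed⇒subgroup : ∀ {H : Fin n → Set} → H ε → (∀ {x y} → H x → H y → H (x ∙ y)) → IsSubgroup H
  closed⇒subgroup {H} ε∈H ∙-closedH = record
    { ε∈ = ε∈H
    ; ∙-closed = ∙-closedH
    ; ⁻¹-closed = λ {x} x∈H → subst H (sym (⁻¹≡pow x)) (pow∈ (order x ∸ 1) x∈H)
    }
    where
    pow∈ : ∀ {x} k → H x → H (pow x k)
    pow∈ zero x∈H = ε∈H
    pow∈ (suc k) x∈H = ∙-closedH x∈H (pow∈ k x∈H)

  -- Lagrange and Cauchy

  record FiniteSubgroup : Set where
    field
      size : ℕ
      elem : Fin size → Fin n
      elem-injective : ∀ {a b} → elem a ≡ elem b → a ≡ b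
      isSubgroup : IsSubgroup (λ y → ∃ λ a → elem a ≡ y)

  open FiniteSubgroup

  infix 4 _∈ᴴ_
  _∈ᴴ_ : Fin n → FiniteSubgroup → Set
  y ∈ᴴ H = ∃ λ a → elem H a ≡ y

  _∈ᴴ?_ : ∀ y H → Dec (y ∈ᴴ H)
  y ∈ᴴ? H = Fin.any? (λ a → elem H a Fin.≟ y)

  trivialSubgroup : FiniteSubgroup
  trivialSubgroup = record
    { size = 1
    ; elem = λ _ → ε
    ; elem-injective = λ { {Fin.zero} {Fin.zero} _ → refl }
    ; isSubgroup = closed⇒subgroup (Fin.zero , refl)
                     λ { (Fin.zero , refl) (Fin.zero , refl) → Fin.zero , sym (identityˡ ε) }
    }

  -- ⟨g⟩H, enumerated as the disjoint cosets gⁱH for i below the index of H in ⟨g⟩H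
  module Extend (H : FiniteSubgroup) (g : Fin n) where

    open IsSubgroup (isSubgroup H)
    open Modulo (_∈ᴴ? H) (isSubgroup H) g public
      renaming (order to index; pow-order∈ to pow-index∈; pow∈⇒order∣ to pow∈⇒index∣)

    coset : Fin index × Fin (size H) → Fin n
    coset (i , a) = pow g (toℕ i) ∙ elem H a

    coset-injective : ∀ u v → coset u ≡ coset v → u ≡ v
    coset-injective (i , a) (i′ , a′) eq
      with Fin.toℕ-injective (cosets-disjoint (Fin.toℕ<n i) (Fin.toℕ<n i′) (a , refl) (a′ , refl) eq)
    ... | refl = cong (i ,_) (elem-injective H (∙-cancelˡ _ _ _ eq))

    elem′ : Fin (index * size H) → Fin n
    elem′ c = coset (Fin.remQuot (size H) c)

    elem′-injective : ∀ {c c′} → elem′ c ≡ elem′ c′ → c ≡ c′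
    elem′-injective {c} {c′} eq = begin
        c                          ≡⟨ Fin.combine-remQuot {index} (size H) c ⟨
        uncurry Fin.combine (rq c)   ≡⟨ cong (uncurry Fin.combine) (coset-injective (rq c) (rq c′) eq) ⟩
        uncurry Fin.combine (rq c′)  ≡⟨ Fin.combine-remQuot {index} (size H) c′ ⟩
        c′                         ∎
      where
      open ≡-Reasoning
      rq = Fin.remQuot {index} (size H)

    _∈′ : Fin n → Set
    y ∈′ = ∃ λ c → elem′ c ≡ y

    coset∈′ : ∀ u → coset u ∈′
    coset∈′ (i , a) = Fin.combine i a , cong coset (Fin.remQuot-combine i a)

    pow∙∈′ : ∀ t {h} → h ∈ᴴ H → (pow g t ∙ h) ∈′
    pow∙∈′ t {h} h∈H with ∙-closed (pow-closed (t / index) pow-index∈) h∈H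
    ... | a , eq = subst _∈′ coset≡ (coset∈′ (fromℕ< (m%n<n t index) , a))
      where
      open ≡-Reasoning
      coset≡ : coset (fromℕ< (m%n<n t index) , a) ≡ pow g t ∙ h
      coset≡ = begin
          pow g (toℕ (fromℕ< (m%n<n t index))) ∙ elem H a        ≡⟨ cong₂ (λ k x → pow g k ∙ x)
                                                                        (Fin.toℕ-fromℕ< (m%n<n t index)) eq ⟩
          pow g (t % index) ∙ (pow (pow g index) (t / index) ∙ h) ≡⟨ assoc _ _ _ ⟨
          pow g (t % index) ∙ pow (pow g index) (t / index) ∙ h   ≡⟨ cong (_∙ h) (pow-divMod g index t) ⟨
          pow g t ∙ h                                             ∎

    coset∙coset∈′ : ∀ u v → (coset u ∙ coset v) ∈′
    coset∙coset∈′ (i , a) (i′ , a′) =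
      subst _∈′ product≡ (pow∙∈′ (toℕ i + toℕ i′) (∙-closed (a , refl) (a′ , refl)))
      where
      product≡ : pow g (toℕ i + toℕ i′) ∙ (elem H a ∙ elem H a′) ≡ coset (i , a) ∙ coset (i′ , a′)
      product≡ = trans (cong (_∙ _) (pow-+ g (toℕ i) (toℕ i′))) (interchange _ _ _ _)

    ∙-closed′ : ∀ {x y} → x ∈′ → y ∈′ → (x ∙ y) ∈′
    ∙-closed′ (c , refl) (c′ , refl) = coset∙coset∈′ (Fin.remQuot (size H) c) (Fin.remQuot (size H) c′)

    extend : FiniteSubgroup
    extend = record
      { size = index * size H
      ; elem = elem′
      ; elem-injective = elem′-injective
      ; isSubgroup = closed⇒subgroup (subst _∈′ (identityˡ ε) (pow∙∈′ 0 ε∈)) ∙-closed′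
      }

    ⊆extend : ∀ {y} → y ∈ᴴ H → y ∈ᴴ extend
    ⊆extend {y} y∈H = subst _∈′ (identityˡ y) (pow∙∈′ 0 y∈H)

    g∈extend : g ∈ᴴ extend
    g∈extend = subst _∈′ (trans (identityʳ _) (pow-1 g)) (pow∙∈′ 1 ε∈)

    index∣order : index ∣ order g
    index∣order = pow∈⇒index∣ (subst (_∈ᴴ H) (sym (pow-order g)) ε∈)

  extendAll : FiniteSubgroup → List (Fin n) → FiniteSubgroup
  extendAll H [] = H
  extendAll H (g ∷ gs) = extendAll (Extend.extend H g) gs

  ⊆extendAll : ∀ {H} gs {y} → y ∈ᴴ H → y ∈ᴴ extendAll H gs
  ⊆extendAll [] y∈H = y∈H
  ⊆extendAll {H} (g ∷ gs) y∈H = ⊆extendAll gs (Extend.⊆extend H g y∈H)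

  ∈extendAll : ∀ {H} gs {y} → y ∈ₗ gs → y ∈ᴴ extendAll H gs
  ∈extendAll {H} (g ∷ gs) (here refl) = ⊆extendAll gs (Extend.g∈extend H g)
  ∈extendAll (g ∷ gs) (there y∈gs) = ∈extendAll gs y∈gs

  size∣extendAll : ∀ H gs → size H ∣ size (extendAll H gs)
  size∣extendAll H [] = ∣-refl
  size∣extendAll H (g ∷ gs) = ∣-trans (n∣m*n (Extend.index H g)) (size∣extendAll (Extend.extend H g) gs)

  prime∣extendAll : ∀ H gs {q} → Prime q → q ∣ size (extendAll H gs) →
                    q ∣ size H ⊎ ∃ λ g → q ∣ order g
  prime∣extendAll H [] pq q∣size = inj₁ q∣size
  prime∣extendAll H (g ∷ gs) pq q∣size with prime∣extendAll (Extend.extend H g) gs pq q∣size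
  ... | inj₂ found = inj₂ found
  ... | inj₁ q∣index*size with euclidsLemma (Extend.index H g) (size H) pq q∣index*size
  ...   | inj₁ q∣index = inj₂ (g , ∣-trans q∣index (Extend.index∣order H g))
  ...   | inj₂ q∣sizeH = inj₁ q∣sizeH

  size-extendAll-allFin : ∀ H → size (extendAll H (allFin n)) ≡ n
  size-extendAll-allFin H =
    ≤-antisym (Fin.injective⇒≤ (elem-injective whole)) (Fin.injective⇒≤ position-injective)
    where
    whole = extendAll H (allFin n)
    member : ∀ y → y ∈ᴴ whole
    member y = ∈extendAll (allFin n) (∈-allFin y)
    position-injective : ∀ {x y} → proj₁ (member x) ≡ proj₁ (member y) → x ≡ y
    position-injective {x} {y} eq =
      trans (sym (proj₂ (member x))) (trans (cong (elem whole) eq) (proj₂ (member y)))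

  size∣n : ∀ H → size H ∣ n
  size∣n H = subst (size H ∣_) (size-extendAll-allFin H) (size∣extendAll H (allFin n))

  order∣n : ∀ x → order x ∣ n
  order∣n x = ∣-trans order∣index (∣-trans (m∣m*n 1) (size∣n (Extend.extend trivialSubgroup x)))
    where
    order∣index : order x ∣ Extend.index trivialSubgroup x
    order∣index = pow≡ε⇒order∣ x (sym (proj₂ (Extend.pow-index∈ trivialSubgroup x)))

  cauchy : ∀ {q} → Prime q → q ∣ n → ∃ λ g → q ∣ order g
  cauchy pq q∣n with prime∣extendAll trivialSubgroup (allFin n) pq
                       (subst (_ ∣_) (sym (size-extendAll-allFin trivialSubgroup)) q∣n)
  ... | inj₁ q∣1 = contradiction (∣1⇒≡1 q∣1) (>⇒≢ (prime>1 pq))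
  ... | inj₂ found = found

  -- Cyclic subgroups

  infix 4 _∈⟨_⟩
  _∈⟨_⟩ : Fin n → Fin n → Set
  u ∈⟨ w ⟩ = IsPowerOf u w

  ∈⟨⟩-refl : ∀ x → x ∈⟨ x ⟩
  ∈⟨⟩-refl x = 1 , sym (pow-1 x)

  ∈⟨⟩-trans : ∀ {u v w} → u ∈⟨ v ⟩ → v ∈⟨ w ⟩ → u ∈⟨ w ⟩
  ∈⟨⟩-trans (k , refl) (k′ , refl) = k′ * k , sym (pow-* _ k′ k)

  ε∈⟨⟩ : ∀ x → ε ∈⟨ x ⟩
  ε∈⟨⟩ x = 0 , refl

  pow∈⟨⟩ : ∀ x k → pow x k ∈⟨ x ⟩
  pow∈⟨⟩ x k = k , refl

  ⁻¹∈⟨⟩ : ∀ x → x ⁻¹ ∈⟨ x ⟩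
  ⁻¹∈⟨⟩ x = order x ∸ 1 , ⁻¹≡pow x

  ∈⟨ε⟩⇒≡ε : ∀ {x} → x ∈⟨ ε ⟩ → x ≡ ε
  ∈⟨ε⟩⇒≡ε (k , refl) = pow-ε k

  ∉⟨⟩⇒≢ε : ∀ {z x} → ¬ z ∈⟨ x ⟩ → z ≢ ε
  ∉⟨⟩⇒≢ε z∉⟨x⟩ refl = z∉⟨x⟩ (ε∈⟨⟩ _)

  _∈⟨_⟩? : ∀ u g → Dec (u ∈⟨ g ⟩)
  u ∈⟨ g ⟩? with Fin.any? {n = order g} (λ i → u Fin.≟ pow g (toℕ i))
  ... | yes (i , u≡gⁱ) = yes (toℕ i , u≡gⁱ)
  ... | no ∄i = no λ (t , u≡gᵗ) → ∄i (fromℕ< (m%n<n t (order g)) ,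
          trans u≡gᵗ (trans (pow-mod-order g t) (cong (pow g) (sym (Fin.toℕ-fromℕ< (m%n<n t (order g)))))))

  coprime⇒∈⟨pow⟩ : ∀ {a b} y → Coprime a b → pow y b ≡ ε → y ∈⟨ pow y a ⟩
  coprime⇒∈⟨pow⟩ {a} {b} y a⊥b yᵇ≡ε with coprime-Bézout a⊥b
  ... | Bézout.+- x u 1+ub≡xa = x , (begin
        y                   ≡⟨ identityʳ y ⟨
        y ∙ ε               ≡⟨ cong (y ∙_) (pow-multiple≡ε yᵇ≡ε u) ⟨
        pow y (1 + u * b)   ≡⟨ cong (pow y) (trans 1+ub≡xa (*-comm x a)) ⟩
        pow y (a * x)       ≡⟨ pow-* y a x ⟩
        pow (pow y a) x     ∎)
    where open ≡-Reasoning
  ... | Bézout.-+ x u 1+xa≡ub = ∈⟨⟩-trans (subst (_∈⟨ t ⟩) (sym y≡t⁻¹) (⁻¹∈⟨⟩ t)) (pow∈⟨⟩ (pow y a) x)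
    where
    open ≡-Reasoning
    t = pow (pow y a) x
    y≡t⁻¹ : y ≡ t ⁻¹
    y≡t⁻¹ = inverseˡ-unique y t (begin
        y ∙ t               ≡⟨ cong (y ∙_) (pow-* y a x) ⟨
        pow y (1 + a * x)   ≡⟨ cong (pow y) (trans (cong suc (*-comm a x)) 1+xa≡ub) ⟩
        pow y (u * b)       ≡⟨ pow-multiple≡ε yᵇ≡ε u ⟩
        ε                   ∎)

  coprime⇒∈⟨∙⟩ : ∀ {r s u v} → Coprime s r → pow u r ≡ ε → pow v s ≡ ε → u ∈⟨ u ∙ v ⟩
  coprime⇒∈⟨∙⟩ {r} {s} {u} {v} s⊥r uʳ≡ε vˢ≡ε =
    ∈⟨⟩-trans (coprime⇒∈⟨pow⟩ u s⊥r uʳ≡ε) (subst (_∈⟨ u ∙ v ⟩) uvˢ≡uˢ (pow∈⟨⟩ (u ∙ v) s))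
    where
    uvˢ≡uˢ : pow (u ∙ v) s ≡ pow u s
    uvˢ≡uˢ = trans (pow-∙ u v s) (trans (cong (pow u s ∙_) vˢ≡ε) (identityʳ _))

  -- for prime p this says that z has order p
  HasOrder : ℕ → Fin n → Set
  HasOrder p z = z ≢ ε × pow z p ≡ ε

  ∣order⇒element-of-order : ∀ g {r} → 1 < r → r ∣ order g → ∃ λ z → HasOrder r z × z ∈⟨ g ⟩
  ∣order⇒element-of-order g 1<r (divides zero o≡0) = contradiction o≡0 λ ()
  ∣order⇒element-of-order g {r} 1<r (divides c@(suc _) o≡cr) =
    pow g c , (order-minimal g z<s c<o , gᶜʳ≡ε) , pow∈⟨⟩ g c
    where
    c<o : c < order g
    c<o = subst (c <_) (sym o≡cr) (subst (_< c * r) (*-identityʳ c) (*-monoʳ-< c 1<r))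
    gᶜʳ≡ε : pow (pow g c) r ≡ ε
    gᶜʳ≡ε = trans (sym (pow-* g c r)) (trans (cong (pow g) (sym o≡cr)) (pow-order g))

  ∃-prime-order-power : ∀ x → x ≢ ε → ∃ λ r → Prime r × ∃ λ z → HasOrder r z × z ∈⟨ x ⟩
  ∃-prime-order-power x x≢ε with ∃-prime-divisor 1<order
    where
    1<order : 1 < order x
    1<order with order x in o≡
    ... | suc zero = contradiction (order≡1⇒≡ε x o≡) x≢ε
    ... | suc (suc _) = s≤s (s≤s z≤n)
  ... | r , pr , r∣o = r , pr , ∣order⇒element-of-order x (prime>1 pr) r∣o

  -- Both t and t′ generate ⟨wᶜ⟩, where order w = c * p.
  prime-order-unique : ∀ {p w t t′} → Prime p → t ∈⟨ w ⟩ → t′ ∈⟨ w ⟩ →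
                       HasOrder p t → HasOrder p t′ → t ∈⟨ t′ ⟩
  prime-order-unique {p} {w} pp (s , refl) (s′ , refl) (_ , tᵖ≡ε) (t′≢ε , t′ᵖ≡ε)
    with p ∣? order w
  ... | no p∤o = contradiction (coprime-divisor (Coprime.sym (prime∤⇒coprime pp p∤o)) o∣ps′)
                               (t′≢ε ∘ order∣⇒pow≡ε w)
    where
    o∣ps′ : order w ∣ p * s′
    o∣ps′ = subst (order w ∣_) (*-comm s′ p) (pow≡ε⇒order∣ w (trans (pow-* w s′ p) t′ᵖ≡ε))
  ... | yes (divides c o≡cp) with c∣ {s} tᵖ≡ε | c∣ {s′} t′ᵖ≡ε
    where
    instance _ = prime⇒nonZero pp
    c∣ : ∀ {k} → pow (pow w k) p ≡ ε → c ∣ k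
    c∣ {k} wᵏᵖ≡ε = *-cancelʳ-∣ p (subst (_∣ k * p) o≡cp (pow≡ε⇒order∣ w (trans (pow-* w k p) wᵏᵖ≡ε)))
  ... | divides q refl | divides q′ refl =
    ∈⟨⟩-trans (q , powᶜ q) (subst (pow w c ∈⟨_⟩) (sym (powᶜ q′)) wᶜ∈⟨t′⟩)
    where
    powᶜ : ∀ k → pow w (k * c) ≡ pow (pow w c) k
    powᶜ k = trans (cong (pow w) (*-comm k c)) (pow-* w c k)
    p∤q′ : ¬ p ∣ q′
    p∤q′ (divides u refl) = t′≢ε (order∣⇒pow≡ε w (divides u (begin
        u * p * c     ≡⟨ *-assoc u p c ⟩
        u * (p * c)   ≡⟨ cong (u *_) (*-comm p c) ⟩
        u * (c * p)   ≡⟨ cong (u *_) o≡cp ⟨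
        u * order w   ∎)))
      where open ≡-Reasoning
    wᶜ∈⟨t′⟩ : pow w c ∈⟨ pow (pow w c) q′ ⟩
    wᶜ∈⟨t′⟩ = coprime⇒∈⟨pow⟩ (pow w c) (Coprime.sym (prime∤⇒coprime pp p∤q′))
                (trans (sym (pow-* w c p)) (trans (cong (pow w) (sym o≡cp)) (pow-order w)))

  -- The enhanced power graph

  Adj : Fin n → Fin n → Set
  Adj = EnhancedPowerAdj G

  adj-sym : Symmetric Adj
  adj-sym (u≢v , w , u∈⟨w⟩ , v∈⟨w⟩) = u≢v ∘ sym , w , v∈⟨w⟩ , u∈⟨w⟩

  ∈⟨⟩⇒reach : ∀ {S u v} → u ∈⟨ v ⟩ → u ∉ S → Reach Adj S v u
  ∈⟨⟩⇒reach {u = u} {v} u∈⟨v⟩ u∉S with v Fin.≟ u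
  ... | yes refl = here
  ... | no v≢u = step (v≢u , v , ∈⟨⟩-refl v , u∈⟨v⟩) u∉S here

  common-root⇒reach : ∀ {S u v w} → u ∈⟨ w ⟩ → v ∈⟨ w ⟩ → u ∉ S → v ∉ S → w ∉ S → Reach Adj S u v
  common-root⇒reach u∈⟨w⟩ v∈⟨w⟩ u∉S v∉S w∉S =
    reach-++ (reach-sym adj-sym w∉S (∈⟨⟩⇒reach u∈⟨w⟩ u∉S)) (∈⟨⟩⇒reach v∈⟨w⟩ v∉S)

  ε∉⇒reach : ∀ {S a b} → ε ∉ S → b ∉ S → Reach Adj S a b
  ε∉⇒reach {a = a} {b} ε∉S b∉S =
    reach-++ (∈⟨⟩⇒reach (ε∈⟨⟩ a) ε∉S) (reach-sym adj-sym b∉S (∈⟨⟩⇒reach (ε∈⟨⟩ b) ε∉S))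

  disconnects⇒ε∈ : ∀ {S} → Disconnects Adj S → ε ∈ S
  disconnects⇒ε∈ {S} (_ , _ , _ , b∉S , ¬reach) with ε ∈? S
  ... | yes ε∈S = ε∈S
  ... | no ε∉S = contradiction (ε∉⇒reach ε∉S b∉S) ¬reach

  disconnects⇒∣S∣>0 : ∀ S → Disconnects Adj S → 0 < ∣ S ∣
  disconnects⇒∣S∣>0 S = x∈p⇒∣p∣>0 ∘ disconnects⇒ε∈

  module Punctured {S : Subset n} (S⊆⁅ε⁆ : S ⊆ ⁅ ε ⁆) where

    ≢ε⇒∉ : ∀ {x} → x ≢ ε → x ∉ S
    ≢ε⇒∉ x≢ε x∈S = x≢ε (x∈⁅y⁆⇒x≡y ε (S⊆⁅ε⁆ x∈S))

    distinct-prime-orders⇒reach : ∀ {r s u v} → Prime r → Prime s → r ≢ s →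
                                  HasOrder r u → HasOrder s v → Reach Adj S u v
    distinct-prime-orders⇒reach {r} {s} {u} {v} pr ps r≢s (u≢ε , uʳ≡ε) (v≢ε , vˢ≡ε) =
      common-root⇒reach u∈⟨uv⟩ v∈⟨uv⟩ (≢ε⇒∉ u≢ε) (≢ε⇒∉ v≢ε) (≢ε⇒∉ uv≢ε)
      where
      u∈⟨uv⟩ : u ∈⟨ u ∙ v ⟩
      u∈⟨uv⟩ = coprime⇒∈⟨∙⟩ (distinctPrimes⇒coprime ps pr (r≢s ∘ sym)) uʳ≡ε vˢ≡ε
      v∈⟨uv⟩ : v ∈⟨ u ∙ v ⟩
      v∈⟨uv⟩ = subst (v ∈⟨_⟩) (comm v u) (coprime⇒∈⟨∙⟩ (distinctPrimes⇒coprime pr ps r≢s) vˢ≡ε uʳ≡ε)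
      uv≢ε : u ∙ v ≢ ε
      uv≢ε uv≡ε = u≢ε (∈⟨ε⟩⇒≡ε (subst (u ∈⟨_⟩) uv≡ε u∈⟨uv⟩))

    reach-prime-order : ∀ {a} → a ≢ ε → ∃ λ r → Prime r × ∃ λ z → HasOrder r z × Reach Adj S a z
    reach-prime-order {a} a≢ε with ∃-prime-order-power a a≢ε
    ... | r , pr , z , z-order@(z≢ε , _) , z∈⟨a⟩ = r , pr , z , z-order , ∈⟨⟩⇒reach z∈⟨a⟩ (≢ε⇒∉ z≢ε)

    -- All elements of prime order reach a fixed yₚ of order p, the ones of order p through some x_q of order q.
    twoPrimes⇒connected : ∀ {p q} → Prime p → Prime q → p ≢ q → p ∣ n → q ∣ n →
                          ∀ {a b} → a ≢ ε → b ≢ ε → Reach Adj S a b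
    twoPrimes⇒connected {p} {q} pp pq p≢q p∣n q∣n {a} {b} a≢ε b≢ε =
      reach-++ (toHub a≢ε) (reach-sym adj-sym (≢ε⇒∉ b≢ε) (toHub b≢ε))
      where
      element-of-order : ∀ {r} → Prime r → r ∣ n → ∃ λ z → HasOrder r z
      element-of-order pr r∣n with cauchy pr r∣n
      ... | g , r∣order = let z , z-order , _ = ∣order⇒element-of-order g (prime>1 pr) r∣order in z , z-order
      yₚ = proj₁ (element-of-order pp p∣n)
      yₚ-order = proj₂ (element-of-order pp p∣n)
      x_q = proj₁ (element-of-order pq q∣n)
      x_q-order = proj₂ (element-of-order pq q∣n)
      primeToHub : ∀ {r z} → Prime r → HasOrder r z → Reach Adj S z yₚ
      primeToHub {r} pr z-order with r ≟ p
      ... | no r≢p = distinct-prime-orders⇒reach pr pp r≢p z-order yₚ-order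
      ... | yes refl = reach-++ (distinct-prime-orders⇒reach pr pq p≢q z-order x_q-order)
                                (distinct-prime-orders⇒reach pq pr (p≢q ∘ sym) x_q-order yₚ-order)
      toHub : ∀ {c} → c ≢ ε → Reach Adj S c yₚ
      toHub c≢ε with reach-prime-order c≢ε
      ... | r , pr , z , z-order , c→z = reach-++ c→z (primeToHub pr z-order)

  disconnected⇒pGroup : ∀ {S} → S ⊆ ⁅ ε ⁆ → Disconnects Adj S → IsPGroup G
  disconnected⇒pGroup {S} S⊆⁅ε⁆ S-disconnects@(a , b , a∉S , b∉S , ¬reach) =
    uniquePrimeDivisor⇒primePower n {{Fin.nonZeroIndex ε}} unique
    where
    open Punctured S⊆⁅ε⁆
    ∉S⇒≢ε : ∀ {x} → x ∉ S → x ≢ ε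
    ∉S⇒≢ε x∉S refl = x∉S (disconnects⇒ε∈ S-disconnects)
    unique : ∀ {p q} → Prime p → Prime q → p ∣ n → q ∣ n → p ≡ q
    unique {p} {q} pp pq p∣n q∣n with p ≟ q
    ... | yes p≡q = p≡q
    ... | no p≢q = contradiction (twoPrimes⇒connected pp pq p≢q p∣n q∣n (∉S⇒≢ε a∉S) (∉S⇒≢ε b∉S)) ¬reach

  module PGroup {p} (pp : Prime p) {r} (n≡pʳ : n ≡ p ^ r) where

    order≡p^ : ∀ x → ∃ λ m → order x ≡ p ^ m
    order≡p^ x = ∣p^r⇒≡p^m pp r (subst (order x ∣_) n≡pʳ (order∣n x))

    ∃-order-p-power : ∀ {x} → x ≢ ε → ∃ λ t → HasOrder p t × t ∈⟨ x ⟩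
    ∃-order-p-power {x} x≢ε with order≡p^ x
    ... | zero , o≡1 = contradiction (order≡1⇒≡ε x o≡1) x≢ε
    ... | suc m , o≡pᵐ⁺¹ =
      ∣order⇒element-of-order x (prime>1 pp) (divides (p ^ m) (trans o≡pᵐ⁺¹ (*-comm p (p ^ m))))

    Meet : Fin n → Fin n → Set
    Meet u v = ∃ λ t → HasOrder p t × t ∈⟨ u ⟩ × t ∈⟨ v ⟩

    meet-refl : ∀ {x} → x ≢ ε → Meet x x
    meet-refl x≢ε with ∃-order-p-power x≢ε
    ... | t , t-order , t∈⟨x⟩ = t , t-order , t∈⟨x⟩ , t∈⟨x⟩

    -- Both ⟨u⟩ and ⟨v⟩ lie in the cyclic ⟨w⟩, whose order-p subgroup is unique.
    meet-adj : ∀ {x u v} → Meet x u → Adj u v → v ≢ ε → Meet x v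
    meet-adj (t , t-order , t∈⟨x⟩ , t∈⟨u⟩) (_ , w , u∈⟨w⟩ , v∈⟨w⟩) v≢ε with ∃-order-p-power v≢ε
    ... | t′ , t′-order , t′∈⟨v⟩ =
      t , t-order , t∈⟨x⟩ ,
      ∈⟨⟩-trans (prime-order-unique pp (∈⟨⟩-trans t∈⟨u⟩ u∈⟨w⟩) (∈⟨⟩-trans t′∈⟨v⟩ v∈⟨w⟩) t-order t′-order)
                t′∈⟨v⟩

    meet-reach : ∀ {x u v} → Meet x u → Reach Adj ⁅ ε ⁆ u v → Meet x v
    meet-reach meet here = meet
    meet-reach meet (step uv v∉⁅ε⁆ reach) = meet-reach (meet-adj meet uv (x∉⁅y⁆⇒x≢y v∉⁅ε⁆)) reach

    ¬meet-outside : ∀ {x z} → ¬ z ∈⟨ x ⟩ → HasOrder p z → ¬ Meet x z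
    ¬meet-outside z∉⟨x⟩ z-order (t , t-order , t∈⟨x⟩ , t∈⟨z⟩) =
      z∉⟨x⟩ (∈⟨⟩-trans (prime-order-unique pp (∈⟨⟩-refl _) t∈⟨z⟩ z-order t-order) t∈⟨x⟩)

    module Maximal {x} (maximal : ∀ y → order y ≤ order x) where

      pow-exponent : ∀ y → pow y (order x) ≡ ε
      pow-exponent y with order≡p^ y | order≡p^ x
      ... | a , oy≡pᵃ | m , ox≡pᵐ = order∣⇒pow≡ε y (subst₂ _∣_ (sym oy≡pᵃ) (sym ox≡pᵐ)
                                      (^≤^⇒^∣^ {p} {a} {m} (prime>1 pp) (subst₂ _≤_ oy≡pᵃ ox≡pᵐ (maximal y))))

      -- With yᵖ = xᵏ, the exponent forces p ∣ k, so y (x^(k/p))⁻¹ has order p and is not in ⟨x⟩.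
      escape : ∀ {y} → ¬ y ∈⟨ x ⟩ → pow y p ∈⟨ x ⟩ → ∃ λ z → ¬ z ∈⟨ x ⟩ × pow z p ≡ ε
      escape {y} y∉⟨x⟩ (k , yᵖ≡xᵏ) with order≡p^ x
      ... | zero , o≡1 =
        contradiction (trans (sym (pow-1 y)) (subst (λ k → pow y k ≡ ε) o≡1 (pow-exponent y))) (∉⟨⟩⇒≢ε y∉⟨x⟩)
      ... | suc m , o≡pᵐ⁺¹ with p∣k
        where
        instance _ = m^n≢0 p m {{prime⇒nonZero pp}}
        xᵏᵖᵐ≡ε : pow x (k * p ^ m) ≡ ε
        xᵏᵖᵐ≡ε = begin
            pow x (k * p ^ m)         ≡⟨ pow-* x k (p ^ m) ⟩
            pow (pow x k) (p ^ m)     ≡⟨ cong (λ z → pow z (p ^ m)) yᵖ≡xᵏ ⟨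
            pow (pow y p) (p ^ m)     ≡⟨ pow-* y p (p ^ m) ⟨
            pow y (p ^ suc m)         ≡⟨ cong (pow y) o≡pᵐ⁺¹ ⟨
            pow y (order x)           ≡⟨ pow-exponent y ⟩
            ε                         ∎
          where open ≡-Reasoning
        p∣k : p ∣ k
        p∣k = *-cancelʳ-∣ (p ^ m) (subst (_∣ k * p ^ m) o≡pᵐ⁺¹ (pow≡ε⇒order∣ x xᵏᵖᵐ≡ε))
      ... | divides k′ refl = z , z∉⟨x⟩ , zᵖ≡ε
        where
        a = pow x k′
        z = y ∙ a ⁻¹
        za≡y : z ∙ a ≡ y
        za≡y = //-rightDividesˡ a y
        zᵖ≡ε : pow z p ≡ ε
        zᵖ≡ε = ∙-cancelʳ (pow a p) _ _ (begin
            pow z p ∙ pow a p   ≡⟨ pow-∙ z a p ⟨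
            pow (z ∙ a) p       ≡⟨ cong (λ u → pow u p) za≡y ⟩
            pow y p             ≡⟨ yᵖ≡xᵏ ⟩
            pow x (k′ * p)      ≡⟨ pow-* x k′ p ⟩
            pow a p             ≡⟨ identityˡ _ ⟨
            ε ∙ pow a p         ∎)
          where open ≡-Reasoning
        z∉⟨x⟩ : ¬ z ∈⟨ x ⟩
        z∉⟨x⟩ (t , z≡xᵗ) =
          y∉⟨x⟩ (t + k′ , trans (sym za≡y) (trans (cong (_∙ a) z≡xᵗ) (sym (pow-+ x t k′))))

      descend : ∀ j {y} → ¬ y ∈⟨ x ⟩ → pow y (p ^ j) ≡ ε → ∃ λ z → ¬ z ∈⟨ x ⟩ × pow z p ≡ ε
      descend zero {y} y∉⟨x⟩ y¹≡ε = contradiction (trans (sym (pow-1 y)) y¹≡ε) (∉⟨⟩⇒≢ε y∉⟨x⟩)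
      descend (suc j) {y} y∉⟨x⟩ yᵖʲ⁺¹≡ε with pow y p ∈⟨ x ⟩?
      ... | yes yᵖ∈⟨x⟩ = escape y∉⟨x⟩ yᵖ∈⟨x⟩
      ... | no yᵖ∉⟨x⟩ = descend j yᵖ∉⟨x⟩ (trans (sym (pow-* y p (p ^ j))) yᵖʲ⁺¹≡ε)

      noncyclic⇒order-p-outside : ¬ IsCyclic G → ∃ λ z → ¬ z ∈⟨ x ⟩ × HasOrder p z
      noncyclic⇒order-p-outside noncyclic with Fin.any? (λ y → ¬? (y ∈⟨ x ⟩?))
      ... | no ∄y = contradiction (x , λ y → decidable-stable (y ∈⟨ x ⟩?) (∄y ∘ (y ,_))) noncyclic
      ... | yes (y , y∉⟨x⟩) with order≡p^ x
      ...   | m , o≡pᵐ with descend m y∉⟨x⟩ (subst (λ k → pow y k ≡ ε) o≡pᵐ (pow-exponent y))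
      ...     | z , z∉⟨x⟩ , zᵖ≡ε = z , z∉⟨x⟩ , ∉⟨⟩⇒≢ε z∉⟨x⟩ , zᵖ≡ε

    noncyclic⇒disconnected : ¬ IsCyclic G → Disconnects Adj ⁅ ε ⁆
    noncyclic⇒disconnected noncyclic =
      let z , z∉⟨x⟩ , z-order = Maximal.noncyclic⇒order-p-outside maximal noncyclic
          x≢ε : x ≢ ε
          x≢ε x≡ε = proj₁ z-order (order≤order-ε⇒≡ε z (subst (λ w → order z ≤ order w) x≡ε (maximal z)))
      in x , z , x≢y⇒x∉⁅y⁆ x≢ε , x≢y⇒x∉⁅y⁆ (proj₁ z-order) ,
         ¬meet-outside z∉⟨x⟩ z-order ∘ meet-reach (meet-refl x≢ε)
      where
      x = argmax order ε (allFin n)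
      maximal : ∀ y → order y ≤ order x
      maximal y = All.lookup (f[xs]≤f[argmax] ε (allFin n)) (∈-allFin y)

mainTheorem2 : ∀ {n : ℕ} (G : FinGroup n) → IsAbelian G → ¬ IsCyclic G →
                 (VertexConnectivityIs (EnhancedPowerAdj G) 1 ⇔ IsPGroup G)
mainTheorem2 G G-abelian noncyclic = mk⇔ κ≡1⇒pGroup pGroup⇒κ≡1
  where
  open FiniteAbelianGroup G G-abelian
  ε = FinGroup.ε G

  κ≡1⇒pGroup : VertexConnectivityIs Adj 1 → IsPGroup G
  κ≡1⇒pGroup ((S , ∣S∣≡1 , S-disconnects) , _) =
    disconnected⇒pGroup (∣p∣≡1∧x∈p⇒p⊆⁅x⁆ ∣S∣≡1 (disconnects⇒ε∈ S-disconnects)) S-disconnects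

  pGroup⇒κ≡1 : IsPGroup G → VertexConnectivityIs Adj 1
  pGroup⇒κ≡1 (p , pp , r , n≡pʳ) =
    (⁅ ε ⁆ , ∣⁅x⁆∣≡1 ε , PGroup.noncyclic⇒disconnected pp {r} n≡pʳ noncyclic) , disconnects⇒∣S∣>0
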